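{- If $A$ is a bounded Wajsberg pseudo-hoop, then every type I state operator on $A$ is a type III state operator on $A$.
   Context: A pseudo-hoop is an algebra $(A,\odot,\rightarrow,\rightsquigarrow,1)$ of type $(2,2,2,0)$ such that for all $x,y,z\in A$: $x\odot 1=1\odot x=x$; $x\rightarrow x=x\rightsquigarrow x=1$; $(x\odot y)\rightarrow z=x\rightarrow(y\rightarrow z)$; $(x\odot y)\rightsquigarrow z=y\rightsquigarrow(x\rightsquigarrow z)$; $(x\rightarrow y)\odot x=(y\rightarrow x)\odot y=x\odot(x\rightsquigarrow y)=y\odot(y\rightsquigarrow x)$. The order is $x\le y$ iff $x\rightarrow y=1$; $x\wedge y=(x\rightarrow y)\odot x$. It is bounded if it has a least element $0$. Put $x\vee_1 y=(x\rightarrow y)\rightsquigarrow y$, $x\vee_2 y=(x\rightsquigarrow y)\rightarrow y$; $A$ is Wajsberg if $x\vee_1 y=y\vee_1 x$ and $x\vee_2 y=y\vee_2 x$ for all $x,y$. For $\mu:A\to A$ and all $x,y$ consider: (IS1) $\mu(x\rightarrow y)=\mu(x\vee_1 y)\rightarrow\mu(y)$ and $\mu(x\rightsquigarrow y)=\mu(x\vee_2 y)\rightsquigarrow\mu(y)$; (IS1'') $\mu(x\rightarrow y)=\mu(x)\rightarrow\mu(x\wedge y)$ and $\mu(x\rightsquigarrow y)=\mu(x)\rightsquigarrow\mu(x\wedge y)$; (IS2) $\mu(x\odot y)=\mu(x)\odot\mu(x\rightsquigarrow x\odot y)=\mu(y\rightarrow x\odot y)\odot\mu(y)$; (IS3)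 $\mu(\mu(x)\odot\mu(y))=\mu(x)\odot\mu(y)$; (IS4) $\mu(\mu(x)\rightarrow\mu(y))=\mu(x)\rightarrow\mu(y)$ and $\mu(\mu(x)\rightsquigarrow\mu(y))=\mu(x)\rightsquigarrow\mu(y)$. A type I state operator satisfies (IS1),(IS2),(IS3),(IS4); a type III state operator satisfies (IS1''),(IS2),(IS3),(IS4). -}

module Defs where

open import Level using (Level; suc)
open import Relation.Binary.PropositionalEquality using (_≡_)
open import Data.Product using (_×_; Σ)

record PseudoHoop (a : Level) : Set (suc a) where
  infixl 7 _⊙_
  infixr 5 _⇒_ _⇝_
  field
    Carrier : Set a
    _⊙_     : Carrier → Carrier → Carrier
    _⇒_     : Carrier → Carrier → Carrier
    _⇝_     : Carrier → Carrier → Carrier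
    𝟙       : Carrier
    ⊙-identityʳ : ∀ x → x ⊙ 𝟙 ≡ x
    ⊙-identityˡ : ∀ x → 𝟙 ⊙ x ≡ x
    ⇒-refl  : ∀ x → x ⇒ x ≡ 𝟙
    ⇝-refl  : ∀ x → x ⇝ x ≡ 𝟙
    ⇒-curry : ∀ x y z → (x ⊙ y) ⇒ z ≡ x ⇒ (y ⇒ z)
    ⇝-curry : ∀ x y z → (x ⊙ y) ⇝ z ≡ y ⇝ (x ⇝ z)
    div₁    : ∀ x y → (x ⇒ y) ⊙ x ≡ (y ⇒ x) ⊙ y
    div₂    : ∀ x y → (y ⇒ x) ⊙ y ≡ x ⊙ (x ⇝ y)
    div₃    : ∀ x y → x ⊙ (x ⇝ y) ≡ y ⊙ (y ⇝ x)

  _≤_ : Carrier → Carrier → Set a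
  x ≤ y = (x ⇒ y) ≡ 𝟙

  _∧_ : Carrier → Carrier → Carrier
  x ∧ y = (x ⇒ y) ⊙ x

  _∨₁_ : Carrier → Carrier → Carrier
  x ∨₁ y = (x ⇒ y) ⇝ y

  _∨₂_ : Carrier → Carrier → Carrier
  x ∨₂ y = (x ⇝ y) ⇒ y

  Bounded : Set a
  Bounded = Σ Carrier (λ z → ∀ x → z ≤ x)

  Wajsberg : Set a
  Wajsberg = (∀ x y → x ∨₁ y ≡ y ∨₁ x) × (∀ x y → x ∨₂ y ≡ y ∨₂ x)

  module _ (μ : Carrier → Carrier) where

    IS1 : Set a
    IS1 = (∀ x y → μ (x ⇒ y) ≡ μ (x ∨₁ y) ⇒ μ y)
        × (∀ x y → μ (x ⇝ y) ≡ μ (x ∨₂ y) ⇝ μ y)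

    IS1'' : Set a
    IS1'' = (∀ x y → μ (x ⇒ y) ≡ μ x ⇒ μ (x ∧ y))
          × (∀ x y → μ (x ⇝ y) ≡ μ x ⇝ μ (x ∧ y))

    IS2 : Set a
    IS2 = ∀ x y → (μ (x ⊙ y) ≡ μ x ⊙ μ (x ⇝ x ⊙ y))
                × (μ x ⊙ μ (x ⇝ x ⊙ y) ≡ μ (y ⇒ x ⊙ y) ⊙ μ y)

    IS3 : Set a
    IS3 = ∀ x y → μ (μ x ⊙ μ y) ≡ μ x ⊙ μ y

    IS4 : Set a
    IS4 = (∀ x y → μ (μ x ⇒ μ y) ≡ μ x ⇒ μ y)
        × (∀ x y → μ (μ x ⇝ μ y) ≡ μ x ⇝ μ y)

    TypeIStateOperator : Set a
    TypeIStateOperator = IS1 × IS2 × IS3 × IS4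

    TypeIIIStateOperator : Set a
    TypeIIIStateOperator = IS1'' × IS2 × IS3 × IS4

-- Since x ∧ y ≤ x, the arrows satisfy x → y = x → (x ∧ y) and
-- x ⇝ y = x ⇝ (x ∧ y), while the Wajsberg identities give
-- x ∨₁ (x ∧ y) = (x ∧ y) ∨₁ x = 1 ⇝ x = x, and likewise for ∨₂.
-- Applying (IS1) to the pair (x, x ∧ y) therefore yields (IS1'').
module Submission where

open import Defs
open import Level using (Level)
open import Relation.Binary.PropositionalEquality
open import Data.Product using (_,_; proj₁; proj₂)

module PseudoHoopProperties {a : Level} (A : PseudoHoop a) where
  open PseudoHoop A
  open ≡-Reasoning

  -- The order read off ⇝.
  _≼_ : Carrier → Carrier → Set a
  x ≼ y = x ⇝ y ≡ 𝟙

  ⇒-antisym : ∀ {x y} → x ≤ y → y ≤ x → x ≡ y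
  ⇒-antisym {x} {y} x≤y y≤x = begin
    x             ≡⟨ sym (⊙-identityˡ x) ⟩
    𝟙 ⊙ x         ≡⟨ cong (_⊙ x) (sym x≤y) ⟩
    (x ⇒ y) ⊙ x   ≡⟨ div₁ x y ⟩
    (y ⇒ x) ⊙ y   ≡⟨ cong (_⊙ y) y≤x ⟩
    𝟙 ⊙ y         ≡⟨ ⊙-identityˡ y ⟩
    y             ∎

  ⇝-antisym : ∀ {x y} → x ≼ y → y ≼ x → x ≡ y
  ⇝-antisym {x} {y} x⇝y≡𝟙 y⇝x≡𝟙 = begin
    x             ≡⟨ sym (⊙-identityʳ x) ⟩
    x ⊙ 𝟙         ≡⟨ cong (x ⊙_) (sym x⇝y≡𝟙) ⟩
    x ⊙ (x ⇝ y)   ≡⟨ div₃ x y ⟩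
    y ⊙ (y ⇝ x)   ≡⟨ cong (y ⊙_) y⇝x≡𝟙 ⟩
    y ⊙ 𝟙         ≡⟨ ⊙-identityʳ y ⟩
    y             ∎

  ⇒-identityˡ : ∀ x → 𝟙 ⇒ x ≡ x
  ⇒-identityˡ x = ⇒-antisym 𝟙⇒x≤x x≤𝟙⇒x
    where
    𝟙⇒x≤x : (𝟙 ⇒ x) ⇒ x ≡ 𝟙
    𝟙⇒x≤x = begin
      (𝟙 ⇒ x) ⇒ x           ≡⟨ cong (_⇒ x) (sym (⊙-identityʳ (𝟙 ⇒ x))) ⟩
      ((𝟙 ⇒ x) ⊙ 𝟙) ⇒ x     ≡⟨ ⇒-curry (𝟙 ⇒ x) 𝟙 x ⟩
      (𝟙 ⇒ x) ⇒ (𝟙 ⇒ x)     ≡⟨ ⇒-refl (𝟙 ⇒ x) ⟩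
      𝟙                     ∎
    x≤𝟙⇒x : x ⇒ (𝟙 ⇒ x) ≡ 𝟙
    x≤𝟙⇒x = begin
      x ⇒ (𝟙 ⇒ x)   ≡⟨ sym (⇒-curry x 𝟙 x) ⟩
      (x ⊙ 𝟙) ⇒ x   ≡⟨ cong (_⇒ x) (⊙-identityʳ x) ⟩
      x ⇒ x         ≡⟨ ⇒-refl x ⟩
      𝟙             ∎

  ⇝-identityˡ : ∀ x → 𝟙 ⇝ x ≡ x
  ⇝-identityˡ x = ⇝-antisym 𝟙⇝x≼x x≼𝟙⇝x
    where
    𝟙⇝x≼x : (𝟙 ⇝ x) ⇝ x ≡ 𝟙
    𝟙⇝x≼x = begin
      (𝟙 ⇝ x) ⇝ x           ≡⟨ cong (_⇝ x) (sym (⊙-identityˡ (𝟙 ⇝ x))) ⟩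
      (𝟙 ⊙ (𝟙 ⇝ x)) ⇝ x     ≡⟨ ⇝-curry 𝟙 (𝟙 ⇝ x) x ⟩
      (𝟙 ⇝ x) ⇝ (𝟙 ⇝ x)     ≡⟨ ⇝-refl (𝟙 ⇝ x) ⟩
      𝟙                     ∎
    x≼𝟙⇝x : x ⇝ (𝟙 ⇝ x) ≡ 𝟙
    x≼𝟙⇝x = begin
      x ⇝ (𝟙 ⇝ x)   ≡⟨ sym (⇝-curry 𝟙 x x) ⟩
      (𝟙 ⊙ x) ⇝ x   ≡⟨ cong (_⇝ x) (⊙-identityˡ x) ⟩
      x ⇝ x         ≡⟨ ⇝-refl x ⟩
      𝟙             ∎

  ∧-comm : ∀ x y → x ∧ y ≡ y ∧ x
  ∧-comm = div₁

  ∧-via-⇝ : ∀ x y → x ∧ y ≡ x ⊙ (x ⇝ y)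
  ∧-via-⇝ x y = trans (div₁ x y) (div₂ x y)

  x∧y≤y : ∀ x y → (x ∧ y) ≤ y
  x∧y≤y x y = trans (⇒-curry (x ⇒ y) x y) (⇒-refl (x ⇒ y))

  x∧y≤x : ∀ x y → (x ∧ y) ≤ x
  x∧y≤x x y = trans (cong (_⇒ x) (∧-comm x y)) (x∧y≤y y x)

  x∧y≼y : ∀ x y → (x ∧ y) ≼ y
  x∧y≼y x y = begin
    (x ∧ y) ⇝ y           ≡⟨ cong (_⇝ y) (∧-via-⇝ x y) ⟩
    (x ⊙ (x ⇝ y)) ⇝ y     ≡⟨ ⇝-curry x (x ⇝ y) y ⟩
    (x ⇝ y) ⇝ (x ⇝ y)     ≡⟨ ⇝-refl (x ⇝ y) ⟩
    𝟙                     ∎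

  x∧y≼x : ∀ x y → (x ∧ y) ≼ x
  x∧y≼x x y = trans (cong (_⇝ x) (∧-comm x y)) (x∧y≼y y x)

  y≤x⇒x∧y≡y : ∀ {x y} → y ≤ x → x ∧ y ≡ y
  y≤x⇒x∧y≡y {x} {y} y≤x = trans (div₁ x y) (trans (cong (_⊙ y) y≤x) (⊙-identityˡ y))

  y≼x⇒x⊙[x⇝y]≡y : ∀ {x y} → y ≼ x → x ⊙ (x ⇝ y) ≡ y
  y≼x⇒x⊙[x⇝y]≡y {x} {y} y≼x = trans (div₃ x y) (trans (cong (y ⊙_) y≼x) (⊙-identityʳ y))

  ⇒-∧ : ∀ x y → x ⇒ (x ∧ y) ≡ x ⇒ y
  ⇒-∧ x y = ⇒-antisym below above
    where
    below : (x ⇒ (x ∧ y)) ⇒ (x ⇒ y) ≡ 𝟙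
    below = begin
      (x ⇒ (x ∧ y)) ⇒ (x ⇒ y)     ≡⟨ sym (⇒-curry (x ⇒ (x ∧ y)) x y) ⟩
      (x ∧ (x ∧ y)) ⇒ y           ≡⟨ cong (_⇒ y) (y≤x⇒x∧y≡y (x∧y≤x x y)) ⟩
      (x ∧ y) ⇒ y                 ≡⟨ x∧y≤y x y ⟩
      𝟙                           ∎
    above : (x ⇒ y) ⇒ (x ⇒ (x ∧ y)) ≡ 𝟙
    above = trans (sym (⇒-curry (x ⇒ y) x (x ∧ y))) (⇒-refl (x ∧ y))

  ⇝-∧ : ∀ x y → x ⇝ (x ∧ y) ≡ x ⇝ y
  ⇝-∧ x y = ⇝-antisym below above
    where
    below : (x ⇝ (x ∧ y)) ⇝ (x ⇝ y) ≡ 𝟙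
    below = begin
      (x ⇝ (x ∧ y)) ⇝ (x ⇝ y)     ≡⟨ sym (⇝-curry x (x ⇝ (x ∧ y)) y) ⟩
      (x ⊙ (x ⇝ (x ∧ y))) ⇝ y     ≡⟨ cong (_⇝ y) (y≼x⇒x⊙[x⇝y]≡y (x∧y≼x x y)) ⟩
      (x ∧ y) ⇝ y                 ≡⟨ x∧y≼y x y ⟩
      𝟙                           ∎
    above : (x ⇝ y) ⇝ (x ⇝ (x ∧ y)) ≡ 𝟙
    above = begin
      (x ⇝ y) ⇝ (x ⇝ (x ∧ y))     ≡⟨ sym (⇝-curry x (x ⇝ y) (x ∧ y)) ⟩
      (x ⊙ (x ⇝ y)) ⇝ (x ∧ y)     ≡⟨ cong (_⇝ (x ∧ y)) (sym (∧-via-⇝ x y)) ⟩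
      (x ∧ y) ⇝ (x ∧ y)           ≡⟨ ⇝-refl (x ∧ y) ⟩
      𝟙                           ∎

  y≤x⇒y∨₁x≡x : ∀ {x y} → y ≤ x → y ∨₁ x ≡ x
  y≤x⇒y∨₁x≡x {x} y≤x = trans (cong (_⇝ x) y≤x) (⇝-identityˡ x)

  y≼x⇒y∨₂x≡x : ∀ {x y} → y ≼ x → y ∨₂ x ≡ x
  y≼x⇒y∨₂x≡x {x} y≼x = trans (cong (_⇒ x) y≼x) (⇒-identityˡ x)

  module _ (wajsberg : Wajsberg) where
    private
      ∨₁-comm : ∀ x y → x ∨₁ y ≡ y ∨₁ x
      ∨₁-comm = proj₁ wajsberg
      ∨₂-comm : ∀ x y → x ∨₂ y ≡ y ∨₂ x
      ∨₂-comm = proj₂ wajsberg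

    x∨₁x∧y≡x : ∀ x y → x ∨₁ (x ∧ y) ≡ x
    x∨₁x∧y≡x x y = trans (∨₁-comm x (x ∧ y)) (y≤x⇒y∨₁x≡x (x∧y≤x x y))

    x∨₂x∧y≡x : ∀ x y → x ∨₂ (x ∧ y) ≡ x
    x∨₂x∧y≡x x y = trans (∨₂-comm x (x ∧ y)) (y≼x⇒y∨₂x≡x (x∧y≼x x y))

    IS1⇒IS1'' : ∀ μ → IS1 μ → IS1'' μ
    IS1⇒IS1'' μ (is1₁ , is1₂) = is1''₁ , is1''₂
      where
      is1''₁ : ∀ x y → μ (x ⇒ y) ≡ μ x ⇒ μ (x ∧ y)
      is1''₁ x y = begin
        μ (x ⇒ y)                     ≡⟨ cong μ (sym (⇒-∧ x y)) ⟩
        μ (x ⇒ (x ∧ y))               ≡⟨ is1₁ x (x ∧ y) ⟩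
        μ (x ∨₁ (x ∧ y)) ⇒ μ (x ∧ y)  ≡⟨ cong (λ t → μ t ⇒ μ (x ∧ y)) (x∨₁x∧y≡x x y) ⟩
        μ x ⇒ μ (x ∧ y)               ∎
      is1''₂ : ∀ x y → μ (x ⇝ y) ≡ μ x ⇝ μ (x ∧ y)
      is1''₂ x y = begin
        μ (x ⇝ y)                     ≡⟨ cong μ (sym (⇝-∧ x y)) ⟩
        μ (x ⇝ (x ∧ y))               ≡⟨ is1₂ x (x ∧ y) ⟩
        μ (x ∨₂ (x ∧ y)) ⇝ μ (x ∧ y)  ≡⟨ cong (λ t → μ t ⇝ μ (x ∧ y)) (x∨₂x∧y≡x x y) ⟩
        μ x ⇝ μ (x ∧ y)               ∎

theorem5p13 : {a : Level} (A : PseudoHoop a) →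
    PseudoHoop.Bounded A → PseudoHoop.Wajsberg A →
    (μ : PseudoHoop.Carrier A → PseudoHoop.Carrier A) →
    PseudoHoop.TypeIStateOperator A μ → PseudoHoop.TypeIIIStateOperator A μ
theorem5p13 A _ wajsberg μ (is1 , is2 , is3 , is4) =
  PseudoHoopProperties.IS1⇒IS1'' A wajsberg μ is1 , is2 , is3 , is4
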